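{- Let $n=p^\alpha$ with $\alpha\ge1$ and $p$ a prime with $p\equiv1\pmod4$, and let $\chi$ be the unique Dirichlet character modulo $n$ of order $2$. Then for every $a\in\mathbb{Z}_n^{\ast}$, $$\sum_{x\in\mathbb{Z}_n^{\ast}}\chi(x^2-a)=-(1+\chi(a))p^{\alpha-1}.$$
   Context: $\mathbb{Z}_n^{\ast}$ is the group of units of $\mathbb{Z}_n$; Dirichlet characters modulo $n$ are regarded as functions on $\mathbb{Z}_n$ that vanish on non-units. -}

module Defs where

open import Data.Nat as ℕ using (ℕ)
open import Data.Nat.Coprimality using (Coprime; coprime?)
open import Data.Integer using (ℤ; +_; _+_; _*_; 0ℤ; 1ℤ; ∣_∣)
open import Data.List using (List; foldr; map; filter; upTo)
open import Data.Product using (Σ; _×_)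
open import Relation.Binary.PropositionalEquality using (_≡_; _≢_)
open import Relation.Nullary using (¬_)

sumℤ : List ℤ → ℤ
sumℤ = foldr _+_ 0ℤ

-- A Dirichlet character modulo n with integer values, regarded as a function
-- on ℤ (hence on ℤ_n via periodicity), vanishing on non-units.
record IsDirichletChar (n : ℕ) (χ : ℤ → ℤ) : Set where
  field
    periodic      : ∀ x → χ (x + + n) ≡ χ x
    multiplicative : ∀ x y → χ (x * y) ≡ χ x * χ y
    one           : χ 1ℤ ≡ 1ℤ
    nonunit-zero  : ∀ x → ¬ Coprime ∣ x ∣ n → χ x ≡ 0ℤ

record HasOrder2 (n : ℕ) (χ : ℤ → ℤ) : Set where
  field
    square-principal : ∀ x → Coprime ∣ x ∣ n → χ x * χ x ≡ 1ℤ
    nonprincipal     : Σ ℤ λ x → Coprime ∣ x ∣ n × χ x ≢ 1ℤ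

units : ℕ → List ℕ
units n = filter (λ x → coprime? x n) (upTo n)

-- Write q = p^(α-1). Among the units modulo n, a unit y has exactly 1 + χ(y) square roots and a
-- non-unit has none: at most that many, since p is odd and so a unit square has only the roots ±x₀,
-- and both counts have the same total. Substituting y = x² therefore splits the sum into
-- ∑_{y unit} χ(y - a) and ∑_{y unit} χ(y)χ(y - a). A character sum over all residues vanishes, and
-- the non-units are the q multiples of p, on which χ(y - a) = χ(-a) because χ only depends on units
-- modulo p (χ(w) = 1 for w ≡ 1 mod p, as w^q ≡ 1 mod n and q is odd); so the first part is -q χ(-a).
-- In the second, χ(y)χ(y - a) = χ(1 - a y⁻¹), and substituting w = a y⁻¹ gives ∑_{w unit} χ(1 - w) = -q.
-- Finally χ(-1) = 1: pairing each unit with its inverse leaves only ±1 fixed and every pair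
-- contributes a multiple of 4 to ∑_{y unit} (1 + χ(y)) = φ(n), so φ(n) ≡ 3 + χ(-1) mod 4,
-- whereas 4 divides φ(n) = (p - 1)q.

module Submission where

open import Defs
open import Data.Nat as ℕ using (ℕ; _%_; _^_; _∸_; _≤_; _<_)
open import Data.Nat.Primality using (Prime)
open import Data.Nat.Coprimality using (Coprime)
open import Data.Integer using (ℤ; +_; _+_; _-_; _*_; -_; 1ℤ)
open import Data.List using (map)
open import Relation.Binary.PropositionalEquality using (_≡_)

open import Data.Nat using (zero; suc; z≤n; s≤s; nonTrivial⇒n>1)
open import Data.Nat.Properties using (anyUpTo?)
open import Data.Nat.Primality using (prime[2]; prime⇒nonZero; prime⇒nonTrivial; prime⇒irreducible; euclidsLemma)
import Data.Nat.Coprimality as Coprime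
open Coprime using (coprime?; coprime-Bézout; coprime-divisor)
open import Data.Nat.Divisibility as ℕ∣ using (∣1⇒≡1; n∣m⇒m%n≡0)
open import Data.Nat.DivMod using (m<n⇒m%n≡m; m≡m%n+[m/n]*n)
open import Data.Nat.GCD using (module Bézout)
open import Data.Integer.DivMod using (_%ℕ_; _/ℕ_; n%ℕd<d; a≡a%ℕn+[a/ℕn]*n)
import Data.Nat.Properties as ℕ
open import Data.Integer as ℤ using (0ℤ; -1ℤ; ∣_∣; -[1+_])
open import Data.Integer.Properties
open import Data.Integer.Tactic.RingSolver using (solve-∀)
open import Data.Integer.Divisibility.Signed as ℤ∣ using (divides; ∣m∣n⇒∣m+n)
open import Data.List using (filter; applyUpTo)
open import Data.Product using (_×_; _,_; Σ; proj₁; proj₂)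
open import Data.Sum using (_⊎_; inj₁; inj₂)
open import Data.Empty using (⊥-elim)
open import Function using (_∘_)
open import Relation.Binary.PropositionalEquality
  using (refl; sym; trans; cong; cong₂; subst; _≢_; module ≡-Reasoning)
open import Relation.Nullary using (Dec; yes; no; does; ¬_; _×-dec_)
open import Relation.Binary.Definitions using (tri<; tri≈; tri>)
open import Data.Bool using (if_then_else_)
open import Relation.Unary using (Pred; Decidable)
open import Level using (0ℓ)

open ≡-Reasoning

𝟙 : ∀ {P : Set} → Dec P → ℤ
𝟙 P? = if does P? then 1ℤ else 0ℤ

𝟙-yes : ∀ {P : Set} (P? : Dec P) → P → 𝟙 P? ≡ 1ℤ
𝟙-yes (yes _) _  = refl
𝟙-yes (no ¬p) p  = ⊥-elim (¬p p)

𝟙-no : ∀ {P : Set} (P? : Dec P) → ¬ P → 𝟙 P? ≡ 0ℤ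
𝟙-no (yes p) ¬p = ⊥-elim (¬p p)
𝟙-no (no _)  _  = refl

𝟙-nonneg : ∀ {P : Set} (P? : Dec P) → 0ℤ ℤ.≤ 𝟙 P?
𝟙-nonneg (yes _) = ℤ.+≤+ z≤n
𝟙-nonneg (no _)  = ℤ.+≤+ z≤n

𝟙-cong : ∀ {P Q : Set} (P? : Dec P) (Q? : Dec Q) → (P → Q) → (Q → P) → 𝟙 P? ≡ 𝟙 Q?
𝟙-cong (yes p) Q? P→Q Q→P = sym (𝟙-yes Q? (P→Q p))
𝟙-cong (no ¬p) Q? P→Q Q→P = sym (𝟙-no Q? (¬p ∘ Q→P))

𝟙-× : ∀ {P Q : Set} (P? : Dec P) (Q? : Dec Q) → 𝟙 (P? ×-dec Q?) ≡ 𝟙 P? * 𝟙 Q?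
𝟙-× (yes _) (yes _) = refl
𝟙-× (yes _) (no _)  = refl
𝟙-× (no _)  _       = refl

𝟙-*-cong : ∀ {P : Set} (P? : Dec P) {a b} → (P → a ≡ b) → 𝟙 P? * a ≡ 𝟙 P? * b
𝟙-*-cong (yes p) P⇒a≡b = cong (1ℤ *_) (P⇒a≡b p)
𝟙-*-cong (no _)  _     = refl

𝟙-≤ : ∀ {P : Set} (P? : Dec P) {t} → (P → 1ℤ ℤ.≤ t) → 0ℤ ℤ.≤ t → 𝟙 P? ℤ.≤ t
𝟙-≤ (yes p) P⇒1≤t _   = P⇒1≤t p
𝟙-≤ (no _)  _     0≤t = 0≤t

δ : ℕ → ℕ → ℤ
δ i j = 𝟙 (i ℕ.≟ j)

δ-refl : ∀ i → δ i i ≡ 1ℤ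
δ-refl i = 𝟙-yes (i ℕ.≟ i) refl

∑< : ℕ → (ℕ → ℤ) → ℤ
∑< zero    f = 0ℤ
∑< (suc n) f = f 0 + ∑< n (f ∘ suc)

syntax ∑< n (λ i → e) = ∑[ i < n ] e

∑-cong : ∀ n {f g : ℕ → ℤ} → (∀ i → i < n → f i ≡ g i) → ∑< n f ≡ ∑< n g
∑-cong zero    eq = refl
∑-cong (suc n) eq = cong₂ _+_ (eq 0 (s≤s z≤n)) (∑-cong n (λ i i<n → eq (suc i) (s≤s i<n)))

∑-distrib-+ : ∀ n (f g : ℕ → ℤ) → ∑[ i < n ] (f i + g i) ≡ ∑< n f + ∑< n g
∑-distrib-+ zero    f g = refl
∑-distrib-+ (suc n) f g = begin
  f 0 + g 0 + ∑[ i < n ] (f (suc i) + g (suc i))    ≡⟨ cong (_+_ (f 0 + g 0)) (∑-distrib-+ n (f ∘ suc) (g ∘ suc)) ⟩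
  f 0 + g 0 + (∑< n (f ∘ suc) + ∑< n (g ∘ suc))      ≡⟨ +-middle-swap (f 0) (g 0) _ _ ⟩
  f 0 + ∑< n (f ∘ suc) + (g 0 + ∑< n (g ∘ suc))      ∎
  where +-middle-swap : ∀ a b c d → a + b + (c + d) ≡ a + c + (b + d)
        +-middle-swap = solve-∀

*-distribˡ-∑ : ∀ n c (f : ℕ → ℤ) → c * ∑< n f ≡ ∑[ i < n ] (c * f i)
*-distribˡ-∑ zero    c f = *-zeroʳ c
*-distribˡ-∑ (suc n) c f = trans (*-distribˡ-+ c (f 0) _) (cong (_+_ (c * f 0)) (*-distribˡ-∑ n c (f ∘ suc)))

*-distribʳ-∑ : ∀ n c (f : ℕ → ℤ) → ∑< n f * c ≡ ∑[ i < n ] (f i * c)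
*-distribʳ-∑ n c f = trans (*-comm (∑< n f) c) (trans (*-distribˡ-∑ n c f) (∑-cong n (λ i _ → *-comm c (f i))))

∑-const : ∀ n c → ∑[ i < n ] c ≡ + n * c
∑-const zero    c = refl
∑-const (suc n) c = begin
  c + ∑[ i < n ] c ≡⟨ cong (_+_ c) (∑-const n c) ⟩
  c + + n * c      ≡⟨ solve c (+ n) ⟩
  + suc n * c      ∎
  where solve : ∀ c m → c + m * c ≡ (1ℤ + m) * c
        solve = solve-∀

∑-zero : ∀ n → ∑[ i < n ] 0ℤ ≡ 0ℤ
∑-zero zero    = refl
∑-zero (suc n) = trans (+-identityˡ _) (∑-zero n)

∑-distrib-- : ∀ n (f g : ℕ → ℤ) → ∑[ i < n ] (f i - g i) ≡ ∑< n f - ∑< n g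
∑-distrib-- n f g = begin
  ∑[ i < n ] (f i - g i)           ≡⟨ ∑-distrib-+ n f (λ i → - g i) ⟩
  ∑< n f + ∑[ i < n ] (- g i)      ≡⟨ cong (_+_ (∑< n f)) (∑-cong n (λ i _ → sym (-1*i≡-i (g i)))) ⟩
  ∑< n f + ∑[ i < n ] (-1ℤ * g i)  ≡⟨ cong (_+_ (∑< n f)) (sym (*-distribˡ-∑ n -1ℤ g)) ⟩
  ∑< n f + -1ℤ * ∑< n g            ≡⟨ cong (_+_ (∑< n f)) (-1*i≡-i (∑< n g)) ⟩
  ∑< n f - ∑< n g                  ∎

∑-+ : ∀ m n (f : ℕ → ℤ) → ∑< (m ℕ.+ n) f ≡ ∑< m f + ∑[ i < n ] f (m ℕ.+ i)
∑-+ zero    n f = sym (+-identityˡ _)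
∑-+ (suc m) n f = trans (cong (_+_ (f 0)) (∑-+ m n (f ∘ suc))) (sym (+-assoc (f 0) _ _))

-- δ (suc i) (suc c) computes to δ i c, and δ (suc i) 0 to 0ℤ.
∑-δ : ∀ n {c} (f : ℕ → ℤ) → c < n → ∑[ i < n ] (δ i c * f i) ≡ f c
∑-δ (suc n) {zero} f _ = begin
  1ℤ * f 0 + ∑[ i < n ] 0ℤ  ≡⟨ cong₂ _+_ (*-identityˡ (f 0)) (∑-zero n) ⟩
  f 0 + 0ℤ                  ≡⟨ +-identityʳ (f 0) ⟩
  f 0                       ∎
∑-δ (suc n) {suc c} f (s≤s c<n) = trans (+-identityˡ _) (∑-δ n (f ∘ suc) c<n)

∑-δ-1 : ∀ n {c} → c < n → ∑[ i < n ] δ i c ≡ 1ℤ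
∑-δ-1 n {c} c<n = trans (∑-cong n (λ i _ → sym (*-identityʳ (δ i c)))) (∑-δ n (λ _ → 1ℤ) c<n)

∑-∣ : ∀ n {d} (f : ℕ → ℤ) → (∀ i → i < n → d ℤ∣.∣ f i) → d ℤ∣.∣ ∑< n f
∑-∣ zero    f d∣f = divides 0ℤ refl
∑-∣ (suc n) f d∣f = ∣m∣n⇒∣m+n (d∣f 0 (s≤s z≤n)) (∑-∣ n (f ∘ suc) (λ i i<n → d∣f (suc i) (s≤s i<n)))

∑-mono-≤ : ∀ n {f g : ℕ → ℤ} → (∀ i → i < n → f i ℤ.≤ g i) → ∑< n f ℤ.≤ ∑< n g
∑-mono-≤ zero    f≤g = ≤-refl
∑-mono-≤ (suc n) f≤g = +-mono-≤ (f≤g 0 (s≤s z≤n)) (∑-mono-≤ n (λ i i<n → f≤g (suc i) (s≤s i<n)))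

∑-comm : ∀ m n (f : ℕ → ℕ → ℤ) → ∑[ i < m ] ∑[ j < n ] f i j ≡ ∑[ j < n ] ∑[ i < m ] f i j
∑-comm zero    n f = sym (trans (∑-cong n (λ _ _ → refl)) (∑-zero n))
∑-comm (suc m) n f = begin
  ∑[ j < n ] f 0 j + ∑[ i < m ] ∑[ j < n ] f (suc i) j  ≡⟨ cong (_+_ (∑[ j < n ] f 0 j)) (∑-comm m n (f ∘ suc)) ⟩
  ∑[ j < n ] f 0 j + ∑[ j < n ] ∑[ i < m ] f (suc i) j  ≡⟨ sym (∑-distrib-+ n _ _) ⟩
  ∑[ j < n ] (f 0 j + ∑[ i < m ] f (suc i) j)           ∎

∑-reindex : ∀ n (f g : ℕ → ℕ) → (∀ y → y < n → f y < n) → (∀ z → z < n → g z < n) →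
            (∀ y → y < n → g (f y) ≡ y) → (∀ z → z < n → f (g z) ≡ z) →
            ∀ F → ∑[ y < n ] F (f y) ≡ ∑< n F
∑-reindex n f g f< g< gf fg F = begin
  ∑[ y < n ] F (f y)                          ≡⟨ ∑-cong n (λ y y<n → sym (∑-δ n F (f< y y<n))) ⟩
  ∑[ y < n ] ∑[ z < n ] (δ z (f y) * F z)     ≡⟨ ∑-comm n n (λ y z → δ z (f y) * F z) ⟩
  ∑[ z < n ] ∑[ y < n ] (δ z (f y) * F z)     ≡⟨ ∑-cong n (λ z z<n → ∑-cong n (λ y y<n → cong (_* F z) (δ-swap y z y<n z<n))) ⟩
  ∑[ z < n ] ∑[ y < n ] (δ y (g z) * F z)     ≡⟨ ∑-cong n (λ z z<n → ∑-δ n (λ _ → F z) (g< z z<n)) ⟩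
  ∑< n F                                      ∎
  where
  δ-swap : ∀ y z → y < n → z < n → δ z (f y) ≡ δ y (g z)
  δ-swap y z y<n z<n = 𝟙-cong (z ℕ.≟ f y) (y ℕ.≟ g z)
    (λ { refl → sym (gf y y<n) }) (λ { refl → sym (fg z z<n) })

δ+𝟙<+𝟙> : ∀ a b → δ a b + 𝟙 (b ℕ.<? a) + 𝟙 (a ℕ.<? b) ≡ 1ℤ
δ+𝟙<+𝟙> a b with ℕ.<-cmp a b
... | tri< a<b a≢b _   = cong₂ _+_ (cong₂ _+_ (𝟙-no (a ℕ.≟ b) a≢b) (𝟙-no (b ℕ.<? a) (ℕ.<-asym a<b))) (𝟙-yes (a ℕ.<? b) a<b)
... | tri≈ _ refl _    = cong₂ _+_ (cong₂ _+_ (δ-refl a) (𝟙-no (a ℕ.<? a) (ℕ.<-irrefl refl))) (𝟙-no (a ℕ.<? a) (ℕ.<-irrefl refl))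
... | tri> _ a≢b b<a   = cong₂ _+_ (cong₂ _+_ (𝟙-no (a ℕ.≟ b) a≢b) (𝟙-yes (b ℕ.<? a) b<a)) (𝟙-no (a ℕ.<? b) (ℕ.<-asym b<a))

-- Off its fixed points an involution pairs y with ι y, and exactly one of each pair has y < ι y.
∑-involution : ∀ n (ι : ℕ → ℕ) → (∀ y → y < n → ι y < n) → (∀ y → y < n → ι (ι y) ≡ y) →
               (h : ℕ → ℤ) → (∀ y → y < n → h (ι y) ≡ h y) →
               ∑< n h ≡ ∑[ y < n ] (δ (ι y) y * h y) + (∑[ y < n ] (𝟙 (y ℕ.<? ι y) * h y) + ∑[ y < n ] (𝟙 (y ℕ.<? ι y) * h y))
∑-involution n ι ι< ι-invol h h∘ι≡h = begin
  ∑< n h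
    ≡⟨ ∑-cong n (λ y _ → sym (trans (cong (_* h y) (δ+𝟙<+𝟙> (ι y) y)) (*-identityˡ (h y)))) ⟩
  ∑[ y < n ] ((δ (ι y) y + 𝟙 (y ℕ.<? ι y) + 𝟙 (ι y ℕ.<? y)) * h y)
    ≡⟨ ∑-cong n (λ y _ → distrib (δ (ι y) y) (𝟙 (y ℕ.<? ι y)) (𝟙 (ι y ℕ.<? y)) (h y)) ⟩
  ∑[ y < n ] (δ (ι y) y * h y + (F y + 𝟙 (ι y ℕ.<? y) * h y))
    ≡⟨ trans (∑-distrib-+ n _ _) (cong (_+_ (∑[ y < n ] (δ (ι y) y * h y))) (∑-distrib-+ n F _)) ⟩
  ∑[ y < n ] (δ (ι y) y * h y) + (∑< n F + ∑[ y < n ] (𝟙 (ι y ℕ.<? y) * h y))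
    ≡⟨ cong (λ t → ∑[ y < n ] (δ (ι y) y * h y) + (∑< n F + t)) ∑F∘ι≡∑F ⟩
  ∑[ y < n ] (δ (ι y) y * h y) + (∑< n F + ∑< n F) ∎
  where
  F : ℕ → ℤ
  F y = 𝟙 (y ℕ.<? ι y) * h y
  distrib : ∀ a b c h → (a + b + c) * h ≡ a * h + (b * h + c * h)
  distrib = solve-∀
  ∑F∘ι≡∑F : ∑[ y < n ] (𝟙 (ι y ℕ.<? y) * h y) ≡ ∑< n F
  ∑F∘ι≡∑F = trans (∑-cong n (λ y y<n → sym (cong₂ (λ z w → 𝟙 (ι y ℕ.<? z) * w) (ι-invol y y<n) (h∘ι≡h y y<n))))
                  (∑-reindex n ι ι ι< ι< ι-invol ι-invol F)

+-≤-≡ˡ : ∀ {a b c d} → a ℤ.≤ b → c ℤ.≤ d → a + c ≡ b + d → a ≡ b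
+-≤-≡ˡ {a} {b} a≤b c≤d eq with a ℤ.≟ b
... | yes a≡b = a≡b
... | no  a≢b = ⊥-elim (<⇒≢ (+-mono-<-≤ (≤∧≢⇒< a≤b a≢b) c≤d) eq)

+-≤-≡ʳ : ∀ {a b c d} → a ℤ.≤ b → c ℤ.≤ d → a + c ≡ b + d → c ≡ d
+-≤-≡ʳ {a} {b} {c} {d} a≤b c≤d eq = +-≤-≡ˡ c≤d a≤b (trans (+-comm c a) (trans eq (+-comm b d)))

∑-mono-≤-≡ : ∀ n {f g : ℕ → ℤ} → (∀ i → i < n → f i ℤ.≤ g i) → ∑< n f ≡ ∑< n g →
             ∀ i → i < n → f i ≡ g i
∑-mono-≤-≡ (suc n) f≤g eq zero    _         = +-≤-≡ˡ (f≤g 0 (s≤s z≤n)) (∑-mono-≤ n (λ i i<n → f≤g (suc i) (s≤s i<n))) eq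
∑-mono-≤-≡ (suc n) f≤g eq (suc i) (s≤s i<n) = ∑-mono-≤-≡ n (λ i i<n → f≤g (suc i) (s≤s i<n))
  (+-≤-≡ʳ (f≤g 0 (s≤s z≤n)) (∑-mono-≤ n (λ i i<n → f≤g (suc i) (s≤s i<n))) eq) i i<n

sumℤ-filter : ∀ {P : Pred ℕ 0ℓ} (P? : Decidable P) (F : ℕ → ℤ) n (h : ℕ → ℕ) →
              sumℤ (map F (filter P? (applyUpTo h n))) ≡ ∑[ i < n ] (𝟙 (P? (h i)) * F (h i))
sumℤ-filter P? F zero    h = refl
sumℤ-filter P? F (suc n) h with P? (h 0)
... | yes _ = cong₂ _+_ (sym (*-identityˡ (F (h 0)))) (sumℤ-filter P? F n (h ∘ suc))
... | no  _ = trans (sumℤ-filter P? F n (h ∘ suc)) (sym (+-identityˡ _))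

infix 4 _≡_mod_
record _≡_mod_ (x y : ℤ) (m : ℕ) : Set where
  constructor ≡mod
  field divides-difference : + m ℤ∣.∣ x - y
open _≡_mod_

module _ {m : ℕ} where

  mod-reflexive : ∀ {x y} → x ≡ y → x ≡ y mod m
  mod-reflexive {x} refl = ≡mod (divides 0ℤ (x-x≡0 x (+ m)))
    where x-x≡0 : ∀ x m → x - x ≡ 0ℤ * m
          x-x≡0 = solve-∀

  mod-refl : ∀ x → x ≡ x mod m
  mod-refl x = mod-reflexive refl

  mod-sym : ∀ {x y} → x ≡ y mod m → y ≡ x mod m
  mod-sym {x} {y} (≡mod m∣x-y) = ≡mod (subst (+ m ℤ∣.∣_) (-[x-y]≡y-x x y) (ℤ∣.∣m⇒∣-m m∣x-y))
    where -[x-y]≡y-x : ∀ x y → - (x - y) ≡ y - x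
          -[x-y]≡y-x = solve-∀

  mod-trans : ∀ {x y z} → x ≡ y mod m → y ≡ z mod m → x ≡ z mod m
  mod-trans {x} {y} {z} (≡mod m∣x-y) (≡mod m∣y-z) =
    ≡mod (subst (+ m ℤ∣.∣_) (telescope x y z) (∣m∣n⇒∣m+n m∣x-y m∣y-z))
    where telescope : ∀ x y z → (x - y) + (y - z) ≡ x - z
          telescope = solve-∀

  +-cong-mod : ∀ {a b c d} → a ≡ b mod m → c ≡ d mod m → a + c ≡ b + d mod m
  +-cong-mod {a} {b} {c} {d} (≡mod m∣a-b) (≡mod m∣c-d) =
    ≡mod (subst (+ m ℤ∣.∣_) (regroup a b c d) (∣m∣n⇒∣m+n m∣a-b m∣c-d))
    where regroup : ∀ a b c d → (a - b) + (c - d) ≡ (a + c) - (b + d)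
          regroup = solve-∀

  -‿cong-mod : ∀ {a b} → a ≡ b mod m → - a ≡ - b mod m
  -‿cong-mod {a} {b} (≡mod m∣a-b) = ≡mod (subst (+ m ℤ∣.∣_) (regroup a b) (ℤ∣.∣m⇒∣-m m∣a-b))
    where regroup : ∀ a b → - (a - b) ≡ - a - - b
          regroup = solve-∀

  *-cong-mod : ∀ {a b c d} → a ≡ b mod m → c ≡ d mod m → a * c ≡ b * d mod m
  *-cong-mod {a} {b} {c} {d} (≡mod m∣a-b) (≡mod m∣c-d) =
    ≡mod (subst (+ m ℤ∣.∣_) (regroup a b c d) (∣m∣n⇒∣m+n (ℤ∣.∣m⇒∣m*n c m∣a-b) (ℤ∣.∣n⇒∣m*n b m∣c-d)))
    where regroup : ∀ a b c d → (a - b) * c + b * (c - d) ≡ a * c - b * d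
          regroup = solve-∀

  *-congˡ-mod : ∀ c {a b} → a ≡ b mod m → c * a ≡ c * b mod m
  *-congˡ-mod c = *-cong-mod (mod-refl c)

  ∣-respects-mod : ∀ {x y} → x ≡ y mod m → + m ℤ∣.∣ y → + m ℤ∣.∣ x
  ∣-respects-mod {x} {y} (≡mod m∣x-y) m∣y = subst (+ m ℤ∣.∣_) (x-y+y≡x x y) (∣m∣n⇒∣m+n m∣x-y m∣y)
    where x-y+y≡x : ∀ x y → (x - y) + y ≡ x
          x-y+y≡x = solve-∀

mod-weaken : ∀ {d m x y} → + d ℤ∣.∣ + m → x ≡ y mod m → x ≡ y mod d
mod-weaken d∣m (≡mod m∣x-y) = ≡mod (ℤ∣.∣-trans d∣m m∣x-y)

module Residues (n : ℕ) .{{_ : ℕ.NonZero n}} where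

  residue : ℤ → ℕ
  residue x = x %ℕ n

  residue-< : ∀ x → residue x < n
  residue-< x = n%ℕd<d x n

  residue-mod : ∀ x → x ≡ + residue x mod n
  residue-mod x = ≡mod (divides (x /ℕ n) (begin
    x - + residue x                              ≡⟨ cong (_- + residue x) (a≡a%ℕn+[a/ℕn]*n x n) ⟩
    + residue x + (x /ℕ n) * + n - + residue x   ≡⟨ cancel (+ residue x) ((x /ℕ n) * + n) ⟩
    (x /ℕ n) * + n                               ∎))
    where cancel : ∀ r t → r + t - r ≡ t
          cancel = solve-∀

  ≡-mod⇒≡ : ∀ {y z} → y < n → z < n → + y ≡ + z mod n → y ≡ z
  ≡-mod⇒≡ {y} {z} y<n z<n (≡mod n∣y-z) = +-injective (i-j≡0⇒i≡j (+ y) (+ z) (∣i∣≡0⇒i≡0 distance≡0))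
    where
    distance : ℕ
    distance = ∣ + y - + z ∣
    distance<n : distance < n
    distance<n = ℕ.≤-<-trans (subst (ℕ._≤ y ℕ.⊔ z) (cong ∣_∣ (sym ([+m]-[+n]≡m⊖n y z))) (∣m⊝n∣≤m⊔n y z))
                             (ℕ.⊔-lub y<n z<n)
    distance≡0 : distance ≡ 0
    distance≡0 = trans (sym (m<n⇒m%n≡m distance<n)) (n∣m⇒m%n≡0 distance n (ℤ∣.∣⇒∣ᵤ n∣y-z))

  inverse-unique : ∀ {a b c} → a * b ≡ 1ℤ mod n → a * c ≡ 1ℤ mod n → b ≡ c mod n
  inverse-unique {a} {b} {c} ab≡1 ac≡1 =
    mod-trans (mod-reflexive (sym (*-identityʳ b)))
    (mod-trans (*-congˡ-mod b (mod-sym ac≡1))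
    (mod-trans (mod-reflexive (reassoc b a c))
    (mod-trans (*-cong-mod ab≡1 (mod-refl c)) (mod-reflexive (*-identityˡ c)))))
    where reassoc : ∀ b a c → b * (a * c) ≡ (a * b) * c
          reassoc = solve-∀

  inverse⇒coprime : ∀ {x y} → x * y ≡ 1ℤ mod n → Coprime ∣ x ∣ n
  inverse⇒coprime {x} {y} (≡mod n∣xy-1) {d} (d∣x , d∣n) = ∣1⇒≡1 (ℤ∣.∣⇒∣ᵤ d∣1)
    where
    d∣1 : + d ℤ∣.∣ 1ℤ
    d∣1 = subst (+ d ℤ∣.∣_) (xy-[xy-1]≡1 x y)
      (ℤ∣.∣m∣n⇒∣m-n (ℤ∣.∣m⇒∣m*n {+ d} {x} y (ℤ∣.∣ᵤ⇒∣ d∣x)) (ℤ∣.∣-trans (ℤ∣.∣ᵤ⇒∣ d∣n) n∣xy-1))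
      where xy-[xy-1]≡1 : ∀ x y → x * y - (x * y - 1ℤ) ≡ 1ℤ
            xy-[xy-1]≡1 = solve-∀

  inverse-mod : ∀ x → Coprime ∣ x ∣ n → Σ ℤ λ x' → x * x' ≡ 1ℤ mod n
  inverse-mod x coprime with +∣i∣≡i⊎+∣i∣≡-i x | Bézout-inverse (coprime-Bézout coprime)
    where
    Bézout-inverse : Bézout.Identity 1 ∣ x ∣ n → Σ ℤ λ x' → + ∣ x ∣ * x' ≡ 1ℤ mod n
    Bézout-inverse (Bézout.+- a b 1+bn≡ax) = + a , ≡mod (divides (+ b) (begin
      + ∣ x ∣ * + a - 1ℤ              ≡⟨ cong (_- 1ℤ) (trans (sym (pos-* ∣ x ∣ a)) (cong +_ (trans (ℕ.*-comm ∣ x ∣ a) (sym 1+bn≡ax)))) ⟩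
      + (1 ℕ.+ b ℕ.* n) - 1ℤ          ≡⟨ cong (λ t → + 1 + t - 1ℤ) (pos-* b n) ⟩
      1ℤ + + b * + n - 1ℤ             ≡⟨ cancel (+ b * + n) ⟩
      + b * + n                       ∎))
      where cancel : ∀ t → 1ℤ + t - 1ℤ ≡ t
            cancel = solve-∀
    Bézout-inverse (Bézout.-+ a b 1+ax≡bn) = - + a , ≡mod (divides (- + b) (begin
      + ∣ x ∣ * - + a - 1ℤ            ≡⟨ regroup (+ ∣ x ∣) (+ a) ⟩
      - (1ℤ + + a * + ∣ x ∣)          ≡⟨ cong (λ t → - (+ 1 + t)) (sym (pos-* a ∣ x ∣)) ⟩
      - + (1 ℕ.+ a ℕ.* ∣ x ∣)         ≡⟨ cong (λ t → - + t) 1+ax≡bn ⟩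
      - + (b ℕ.* n)                   ≡⟨ cong -_ (pos-* b n) ⟩
      - (+ b * + n)                   ≡⟨ neg-distribˡ-* (+ b) (+ n) ⟩
      - + b * + n                     ∎))
      where regroup : ∀ m a → m * - a - 1ℤ ≡ - (1ℤ + a * m)
            regroup = solve-∀
  ... | inj₁ ∣x∣≡x  | x' , ∣x∣x'≡1 = x' , subst (λ t → t * x' ≡ 1ℤ mod n) ∣x∣≡x ∣x∣x'≡1
  ... | inj₂ ∣x∣≡-x | x' , ∣x∣x'≡1 = - x' , mod-trans (mod-reflexive (neg-swap x x')) (subst (λ t → t * x' ≡ 1ℤ mod n) ∣x∣≡-x ∣x∣x'≡1)
    where neg-swap : ∀ x y → x * - y ≡ - x * y
          neg-swap = solve-∀

  invert : ℕ → ℕ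
  invert y with coprime? y n
  ... | yes coprime = residue (proj₁ (inverse-mod (+ y) coprime))
  ... | no  _       = y

  invert-< : ∀ {y} → y < n → invert y < n
  invert-< {y} y<n with coprime? y n
  ... | yes coprime = residue-< (proj₁ (inverse-mod (+ y) coprime))
  ... | no  _       = y<n

  invert-inverse : ∀ {y} → Coprime y n → + y * + invert y ≡ 1ℤ mod n
  invert-inverse {y} coprime with coprime? y n
  ... | yes c = mod-trans (*-congˡ-mod (+ y) (mod-sym (residue-mod (proj₁ (inverse-mod (+ y) c))))) (proj₂ (inverse-mod (+ y) c))
  ... | no ¬c = ⊥-elim (¬c coprime)

  invert-nonunit : ∀ {y} → ¬ Coprime y n → invert y ≡ y
  invert-nonunit {y} ¬coprime with coprime? y n
  ... | yes c = ⊥-elim (¬coprime c)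
  ... | no  _ = refl

  invert-coprime : ∀ {y} → Coprime y n → Coprime (invert y) n
  invert-coprime {y} coprime = inverse⇒coprime {+ invert y}
    (mod-trans (mod-reflexive (*-comm (+ invert y) (+ y))) (invert-inverse coprime))

  invert-involutive : ∀ {y} → y < n → invert (invert y) ≡ y
  invert-involutive {y} y<n = by-cases (coprime? y n)
    where
    by-cases : Dec (Coprime y n) → invert (invert y) ≡ y
    by-cases (no ¬coprime) = trans (cong invert (invert-nonunit ¬coprime)) (invert-nonunit ¬coprime)
    by-cases (yes coprime) = ≡-mod⇒≡ (invert-< (invert-< y<n)) y<n (inverse-unique {+ invert y}
      (invert-inverse (invert-coprime coprime))
      (mod-trans (mod-reflexive (*-comm (+ invert y) (+ y))) (invert-inverse coprime)))

  affine : ℤ → ℤ → ℕ → ℕ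
  affine s c y = residue (s * + y + c)

  affine-mod : ∀ s c y → + affine s c y ≡ s * + y + c mod n
  affine-mod s c y = mod-sym (residue-mod (s * + y + c))

  affine-inverse : ∀ s c s' d → s * s' ≡ 1ℤ mod n → s * d + c ≡ 0ℤ mod n →
                   ∀ {z} → z < n → affine s c (affine s' d z) ≡ z
  affine-inverse s c s' d ss'≡1 sd+c≡0 {z} z<n = ≡-mod⇒≡ (residue-< (s * + affine s' d z + c)) z<n (
    mod-trans (affine-mod s c (affine s' d z)) (
    mod-trans (+-cong-mod (*-congˡ-mod s (affine-mod s' d z)) (mod-refl c)) (
    mod-trans (mod-reflexive (regroup s s' c d (+ z))) (
    mod-trans (+-cong-mod (*-cong-mod ss'≡1 (mod-refl (+ z))) sd+c≡0) (
    mod-reflexive (unit (+ z)))))))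
    where regroup : ∀ s s' c d z → s * (s' * z + d) + c ≡ (s * s') * z + (s * d + c)
          regroup = solve-∀
          unit : ∀ z → 1ℤ * z + 0ℤ ≡ z
          unit = solve-∀

  ∑-affine : ∀ s s' → s * s' ≡ 1ℤ mod n → ∀ c F → ∑[ y < n ] F (affine s c y) ≡ ∑< n F
  ∑-affine s s' ss'≡1 c F = ∑-reindex n (affine s c) (affine s' d)
    (λ y _ → residue-< (s * + y + c)) (λ z _ → residue-< (s' * + z + d))
    (λ _ → affine-inverse s' d s c (mod-trans (mod-reflexive (*-comm s' s)) ss'≡1) (mod-reflexive (s'c-s'c≡0 s' c)))
    (λ _ → affine-inverse s c s' d ss'≡1 sd+c≡0)
    F
    where
    d : ℤ
    d = - (s' * c)
    s'c-s'c≡0 : ∀ s' c → s' * c + - (s' * c) ≡ 0ℤ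
    s'c-s'c≡0 = solve-∀
    regroup : ∀ s s' c → s * - (s' * c) + c ≡ - ((s * s') * c) + c
    regroup = solve-∀
    cancel : ∀ c → - (1ℤ * c) + c ≡ 0ℤ
    cancel = solve-∀
    sd+c≡0 : s * d + c ≡ 0ℤ mod n
    sd+c≡0 = mod-trans (mod-reflexive (regroup s s' c))
      (mod-trans (+-cong-mod (-‿cong-mod (*-cong-mod ss'≡1 (mod-refl c))) (mod-refl c)) (mod-reflexive (cancel c)))

*-self≡1⇒±1 : ∀ a → a * a ≡ 1ℤ → a ≡ 1ℤ ⊎ a ≡ -1ℤ
*-self≡1⇒±1 a aa≡1 with ℕ.m*n≡1⇒m≡1 ∣ a ∣ ∣ a ∣ (trans (sym (abs-* a a)) (cong ∣_∣ aa≡1))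
*-self≡1⇒±1 (+ .1)     _ | refl = inj₁ refl
*-self≡1⇒±1 -[1+ .0 ]  _ | refl = inj₂ refl

*≡1-unique : ∀ {a b c} → a * b ≡ 1ℤ → c * b ≡ 1ℤ → a ≡ c
*≡1-unique {a} {b} {c} ab≡1 cb≡1 = begin
  a              ≡⟨ sym (*-identityʳ a) ⟩
  a * 1ℤ         ≡⟨ cong (a *_) (sym cb≡1) ⟩
  a * (c * b)    ≡⟨ regroup a b c ⟩
  (a * b) * c    ≡⟨ cong (_* c) ab≡1 ⟩
  1ℤ * c         ≡⟨ *-identityˡ c ⟩
  c              ∎
  where regroup : ∀ a b c → a * (c * b) ≡ (a * b) * c
        regroup = solve-∀

module QuadraticCharacter (n : ℕ) .{{_ : ℕ.NonZero n}} (χ : ℤ → ℤ)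
                  (isχ : IsDirichletChar n χ) (order2 : HasOrder2 n χ) where
  open IsDirichletChar isχ
  open HasOrder2 order2
  open Residues n

  χ-+-multipleℕ : ∀ y t → χ (y + + t * + n) ≡ χ y
  χ-+-multipleℕ y zero    = cong χ (+-identityʳ y)
  χ-+-multipleℕ y (suc t) = begin
    χ (y + + suc t * + n)          ≡⟨ cong χ (regroup y (+ t) (+ n)) ⟩
    χ ((y + + t * + n) + + n)      ≡⟨ periodic _ ⟩
    χ (y + + t * + n)              ≡⟨ χ-+-multipleℕ y t ⟩
    χ y                            ∎
    where regroup : ∀ y t n → y + (1ℤ + t) * n ≡ (y + t * n) + n
          regroup = solve-∀

  χ-+-multiple : ∀ y t → χ (y + t * + n) ≡ χ y
  χ-+-multiple y (+ t)    = χ-+-multipleℕ y t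
  χ-+-multiple y -[1+ t ] = sym (begin
    χ y                                            ≡⟨ cong χ (regroup y (+ suc t) (+ n)) ⟩
    χ ((y + -[1+ t ] * + n) + + suc t * + n)       ≡⟨ χ-+-multipleℕ (y + -[1+ t ] * + n) (suc t) ⟩
    χ (y + -[1+ t ] * + n)                         ∎)
    where regroup : ∀ y t n → y ≡ (y + (- t) * n) + t * n
          regroup = solve-∀

  χ-mod : ∀ {x y} → x ≡ y mod n → χ x ≡ χ y
  χ-mod {x} {y} (≡mod (divides t x-y≡tn)) = trans (cong χ x≡y+tn) (χ-+-multiple y t)
    where x≡y+tn : x ≡ y + t * + n
          x≡y+tn = trans (sym (y+[x-y]≡x y x)) (cong (_+_ y) x-y≡tn)
            where y+[x-y]≡x : ∀ y x → y + (x - y) ≡ x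
                  y+[x-y]≡x = solve-∀

  χ-residue : ∀ x → χ (+ residue x) ≡ χ x
  χ-residue x = χ-mod (mod-sym (residue-mod x))

  χ-±1 : ∀ {x} → Coprime ∣ x ∣ n → χ x ≡ 1ℤ ⊎ χ x ≡ -1ℤ
  χ-±1 {x} coprime = *-self≡1⇒±1 (χ x) (square-principal x coprime)

  χ-^ : ∀ w m → χ (w ℤ.^ m) ≡ χ w ℤ.^ m
  χ-^ w zero    = one
  χ-^ w (suc m) = trans (multiplicative w (w ℤ.^ m)) (cong (χ w *_) (χ-^ w m))

  χ-inverse : ∀ {x x'} → x * x' ≡ 1ℤ mod n → χ x * χ x' ≡ 1ℤ
  χ-inverse {x} {x'} xx'≡1 = trans (sym (multiplicative x x')) (trans (χ-mod xx'≡1) one)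

  χ-invert : ∀ y → χ (+ invert y) ≡ χ (+ y)
  χ-invert y = by-cases (coprime? y n)
    where
    by-cases : Dec (Coprime y n) → χ (+ invert y) ≡ χ (+ y)
    by-cases (no ¬coprime) = cong (χ ∘ +_) (invert-nonunit ¬coprime)
    by-cases (yes coprime) = *≡1-unique
      (χ-inverse (mod-trans (mod-reflexive (*-comm (+ invert y) (+ y))) (invert-inverse coprime)))
      (square-principal (+ y) coprime)

  ∑-χ : ∑[ y < n ] χ (+ y) ≡ 0ℤ
  ∑-χ with nonprincipal
  ... | t , coprime , χt≢1 with χ-±1 coprime | inverse-mod t coprime
  ...   | inj₁ χt≡1  | _          = ⊥-elim (χt≢1 χt≡1)
  ...   | inj₂ χt≡-1 | t' , tt'≡1 = i≡-i⇒i≡0 (begin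
    ∑[ y < n ] χ (+ y)                   ≡⟨ sym (∑-affine t t' tt'≡1 0ℤ (χ ∘ +_)) ⟩
    ∑[ y < n ] χ (+ affine t 0ℤ y)       ≡⟨ ∑-cong n (λ y _ → χ-residue (t * + y + 0ℤ)) ⟩
    ∑[ y < n ] χ (t * + y + 0ℤ)          ≡⟨ ∑-cong n (λ y _ → trans (cong χ (+-identityʳ _)) (multiplicative t (+ y))) ⟩
    ∑[ y < n ] (χ t * χ (+ y))           ≡⟨ sym (*-distribˡ-∑ n (χ t) (χ ∘ +_)) ⟩
    χ t * ∑[ y < n ] χ (+ y)             ≡⟨ cong (_* ∑[ y < n ] χ (+ y)) χt≡-1 ⟩
    -1ℤ * ∑[ y < n ] χ (+ y)             ≡⟨ -1*i≡-i _ ⟩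
    - ∑[ y < n ] χ (+ y)                 ∎)
    where i≡-i⇒i≡0 : ∀ {i} → i ≡ - i → i ≡ 0ℤ
          i≡-i⇒i≡0 {+ zero}   _  = refl
          i≡-i⇒i≡0 {+ suc _}  ()
          i≡-i⇒i≡0 { -[1+ _ ]} ()

  ∑-χ-affine : ∀ s → Coprime ∣ s ∣ n → ∀ c → ∑[ y < n ] χ (s * + y + c) ≡ 0ℤ
  ∑-χ-affine s coprime c with inverse-mod s coprime
  ... | s' , ss'≡1 = begin
    ∑[ y < n ] χ (s * + y + c)           ≡⟨ ∑-cong n (λ y _ → sym (χ-residue (s * + y + c))) ⟩
    ∑[ y < n ] χ (+ affine s c y)        ≡⟨ ∑-affine s s' ss'≡1 c (χ ∘ +_) ⟩
    ∑[ y < n ] χ (+ y)                   ≡⟨ ∑-χ ⟩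
    0ℤ                                   ∎

geometric : ℤ → ℕ → ℤ
geometric y zero    = 0ℤ
geometric y (suc m) = 1ℤ + y * geometric y m

^-1≡[y-1]*geometric : ∀ y m → y ℤ.^ m - 1ℤ ≡ (y - 1ℤ) * geometric y m
^-1≡[y-1]*geometric y zero    = sym (*-zeroʳ (y - 1ℤ))
^-1≡[y-1]*geometric y (suc m) = begin
  y * y ℤ.^ m - 1ℤ                       ≡⟨ regroup y (y ℤ.^ m) ⟩
  y * (y ℤ.^ m - 1ℤ) + (y - 1ℤ)          ≡⟨ cong (λ t → y * t + (y - 1ℤ)) (^-1≡[y-1]*geometric y m) ⟩
  y * ((y - 1ℤ) * geometric y m) + (y - 1ℤ)  ≡⟨ factor y (geometric y m) ⟩
  (y - 1ℤ) * (1ℤ + y * geometric y m)    ∎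
  where regroup : ∀ y z → y * z - 1ℤ ≡ y * (z - 1ℤ) + (y - 1ℤ)
        regroup = solve-∀
        factor : ∀ y g → y * ((y - 1ℤ) * g) + (y - 1ℤ) ≡ (y - 1ℤ) * (1ℤ + y * g)
        factor = solve-∀

y-1∣geometric-m : ∀ y m → (y - 1ℤ) ℤ∣.∣ geometric y m - + m
y-1∣geometric-m y zero    = divides 0ℤ refl
y-1∣geometric-m y (suc m) = subst ((y - 1ℤ) ℤ∣.∣_) (trans (regroup y (geometric y m) (+ m)) (cong (λ t → 1ℤ + y * geometric y m - t) (sym (pos-+ 1 m))))
  (∣m∣n⇒∣m+n (ℤ∣.∣n⇒∣m*n (geometric y m) (ℤ∣.∣-refl {y - 1ℤ})) (y-1∣geometric-m y m))
  where regroup : ∀ y g m → g * (y - 1ℤ) + (g - m) ≡ 1ℤ + y * g - (1ℤ + m)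
        regroup = solve-∀

-- y^p - 1 = (y - 1) · geometric y p, and geometric y p ≡ p modulo y - 1, which p divides.
^-≡1-mod : ∀ {y m} p → y ≡ 1ℤ mod m → + p ℤ∣.∣ + m → y ℤ.^ p ≡ 1ℤ mod (p ℕ.* m)
^-≡1-mod {y} {m} p (≡mod (divides t y-1≡tm)) p∣m = ≡mod (divides (t * g') (begin
  y ℤ.^ p - 1ℤ                ≡⟨ ^-1≡[y-1]*geometric y p ⟩
  (y - 1ℤ) * geometric y p    ≡⟨ cong₂ _*_ y-1≡tm g≡g'p ⟩
  (t * + m) * (g' * + p)      ≡⟨ regroup t (+ m) g' (+ p) ⟩
  (t * g') * (+ p * + m)      ≡⟨ cong ((t * g') *_) (sym (pos-* p m)) ⟩
  (t * g') * + (p ℕ.* m)      ∎))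
  where
  p∣y-1 : + p ℤ∣.∣ y - 1ℤ
  p∣y-1 = ℤ∣.∣-trans p∣m (divides t y-1≡tm)
  p∣g : + p ℤ∣.∣ geometric y p
  p∣g = subst (+ p ℤ∣.∣_) (g-p+p≡g (geometric y p) (+ p))
    (∣m∣n⇒∣m+n (ℤ∣.∣-trans p∣y-1 (y-1∣geometric-m y p)) (ℤ∣.∣-refl {+ p}))
    where g-p+p≡g : ∀ g p → (g - p) + p ≡ g
          g-p+p≡g = solve-∀
  g' : ℤ
  g' = ℤ∣._∣_.quotient p∣g
  g≡g'p : geometric y p ≡ g' * + p
  g≡g'p = ℤ∣._∣_.equality p∣g
  regroup : ∀ t m g p → (t * m) * (g * p) ≡ (t * g) * (p * m)
  regroup = solve-∀

^-lift : ∀ {p} j w → w ≡ 1ℤ mod p → w ℤ.^ (p ^ j) ≡ 1ℤ mod (p ^ suc j)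
^-lift {p} zero    w w≡1 = subst (λ m → w * 1ℤ ≡ 1ℤ mod m) (sym (ℕ.*-identityʳ p))
                                 (mod-trans (mod-reflexive (*-identityʳ w)) w≡1)
^-lift {p} (suc j) w w≡1 = subst (λ z → z ≡ 1ℤ mod (p ^ suc (suc j))) (^-*-comm-assoc w (p ^ j) p)
  (^-≡1-mod p (^-lift j w w≡1) (divides (+ (p ^ j)) (trans (pos-* p (p ^ j)) (*-comm (+ p) (+ (p ^ j))))))
  where ^-*-comm-assoc : ∀ w a b → (w ℤ.^ a) ℤ.^ b ≡ w ℤ.^ (b ℕ.* a)
        ^-*-comm-assoc w a b = trans (^-*-assoc w a b) (cong (w ℤ.^_) (ℕ.*-comm a b))

module PrimePower {p : ℕ} (prime : Prime p) (k : ℕ) where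

  n q : ℕ
  n = p ^ suc k
  q = p ^ k

  instance
    p≢0 : ℕ.NonZero p
    p≢0 = prime⇒nonZero prime
    n≢0 : ℕ.NonZero n
    n≢0 = ℕ.m^n≢0 p (suc k)
    q≢0 : ℕ.NonZero q
    q≢0 = ℕ.m^n≢0 p k

  1<p : 1 < p
  1<p = nonTrivial⇒n>1 p {{prime⇒nonTrivial prime}}

  p∣n : + p ℤ∣.∣ + n
  p∣n = divides (+ q) (trans (pos-* p q) (*-comm (+ p) (+ q)))

  ¬p∣⇒coprime-p : ∀ {y} → ¬ p ℕ∣.∣ y → Coprime y p
  ¬p∣⇒coprime-p ¬p∣y {d} (d∣y , d∣p) with prime⇒irreducible prime d∣p
  ... | inj₁ d≡1 = d≡1
  ... | inj₂ refl = ⊥-elim (¬p∣y d∣y)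

  ¬p∣⇒coprime : ∀ {y} j → ¬ p ℕ∣.∣ y → Coprime y (p ^ j)
  ¬p∣⇒coprime zero    ¬p∣y (_ , d∣1)       = ∣1⇒≡1 d∣1
  ¬p∣⇒coprime {y} (suc j) ¬p∣y {d} (d∣y , d∣pᵏ⁺¹) =
    ¬p∣⇒coprime j ¬p∣y (d∣y , coprime-divisor (¬p∣⇒coprime-p (λ p∣d → ¬p∣y (ℕ∣.∣-trans p∣d d∣y))) d∣pᵏ⁺¹)

  coprime⇒¬p∣ : ∀ {y} → Coprime y n → ¬ p ℕ∣.∣ y
  coprime⇒¬p∣ coprime p∣y = ℕ.<⇒≢ 1<p (sym (coprime (p∣y , ℕ∣.m∣m*n q)))

  IsUnit : ℤ → Set
  IsUnit x = ¬ + p ℤ∣.∣ x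

  unit⇒coprime : ∀ {x} → IsUnit x → Coprime ∣ x ∣ n
  unit⇒coprime unit = ¬p∣⇒coprime (suc k) (unit ∘ ℤ∣.∣ᵤ⇒∣)

  coprime⇒unit : ∀ {x} → Coprime ∣ x ∣ n → IsUnit x
  coprime⇒unit coprime = coprime⇒¬p∣ coprime ∘ ℤ∣.∣⇒∣ᵤ

  unit-1 : IsUnit 1ℤ
  unit-1 p∣1 = ℕ.<⇒≢ 1<p (sym (∣1⇒≡1 (ℤ∣.∣⇒∣ᵤ p∣1)))

  unit-* : ∀ {a b} → IsUnit a → IsUnit b → IsUnit (a * b)
  unit-* {a} {b} unit-a unit-b p∣ab
    with euclidsLemma ∣ a ∣ ∣ b ∣ prime (subst (p ℕ∣.∣_) (abs-* a b) (ℤ∣.∣⇒∣ᵤ p∣ab))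
  ... | inj₁ p∣a = unit-a (ℤ∣.∣ᵤ⇒∣ p∣a)
  ... | inj₂ p∣b = unit-b (ℤ∣.∣ᵤ⇒∣ p∣b)

  unit-mod : ∀ {x y} → x ≡ y mod p → IsUnit y → IsUnit x
  unit-mod {x} {y} x≡y unit-y p∣x = unit-y (∣-respects-mod (mod-sym x≡y) p∣x)

  𝟙ᵤ : ℕ → ℤ
  𝟙ᵤ y = 𝟙 (coprime? y n)

  𝟙ᵤ≡1-𝟙p∣ : ∀ y → 𝟙ᵤ y ≡ 1ℤ - 𝟙 (p ℕ∣.∣? y)
  𝟙ᵤ≡1-𝟙p∣ y with p ℕ∣.∣? y
  ... | yes p∣y = 𝟙-no (coprime? y n) (λ coprime → coprime⇒¬p∣ coprime p∣y)
  ... | no ¬p∣y = 𝟙-yes (coprime? y n) (¬p∣⇒coprime (suc k) ¬p∣y)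

  𝟙p∣-small : ∀ {y} → y < p → 𝟙 (p ℕ∣.∣? y) ≡ δ y 0
  𝟙p∣-small {y} y<p = 𝟙-cong (p ℕ∣.∣? y) (y ℕ.≟ 0) (p∣⇒≡0 y<p) (λ { refl → p ℕ∣.∣0 })
    where p∣⇒≡0 : ∀ {y} → y < p → p ℕ∣.∣ y → y ≡ 0
          p∣⇒≡0 {zero}  _   _   = refl
          p∣⇒≡0 {suc _} y<p p∣y = ⊥-elim (ℕ.<⇒≱ y<p (ℕ∣.∣⇒≤ p∣y))

  ∑-multiples : ∀ r (G : ℕ → ℤ) → ∑[ y < r ℕ.* p ] (𝟙 (p ℕ∣.∣? y) * G y) ≡ ∑[ j < r ] G (j ℕ.* p)
  ∑-multiples zero    G = refl
  ∑-multiples (suc r) G = begin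
    ∑[ y < p ℕ.+ r ℕ.* p ] (𝟙 (p ℕ∣.∣? y) * G y)
      ≡⟨ ∑-+ p (r ℕ.* p) (λ y → 𝟙 (p ℕ∣.∣? y) * G y) ⟩
    ∑[ y < p ] (𝟙 (p ℕ∣.∣? y) * G y) + ∑[ i < r ℕ.* p ] (𝟙 (p ℕ∣.∣? (p ℕ.+ i)) * G (p ℕ.+ i))
      ≡⟨ cong₂ _+_ (trans (∑-cong p (λ y y<p → cong (_* G y) (𝟙p∣-small y<p))) (∑-δ p G (ℕ.<-trans (s≤s z≤n) 1<p)))
                   (∑-cong (r ℕ.* p) (λ i _ → cong (_* G (p ℕ.+ i)) (𝟙p∣-shift i))) ⟩
    G 0 + ∑[ i < r ℕ.* p ] (𝟙 (p ℕ∣.∣? i) * G (p ℕ.+ i))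
      ≡⟨ cong (_+_ (G 0)) (∑-multiples r (λ i → G (p ℕ.+ i))) ⟩
    G 0 + ∑[ j < r ] G (p ℕ.+ j ℕ.* p) ∎
    where 𝟙p∣-shift : ∀ i → 𝟙 (p ℕ∣.∣? (p ℕ.+ i)) ≡ 𝟙 (p ℕ∣.∣? i)
          𝟙p∣-shift i = 𝟙-cong (p ℕ∣.∣? (p ℕ.+ i)) (p ℕ∣.∣? i)
            (λ p∣p+i → ℕ∣.∣m+n∣m⇒∣n p∣p+i ℕ∣.∣-refl) (ℕ∣.∣m∣n⇒∣m+n ℕ∣.∣-refl)

  ∑-units : ∀ (G : ℕ → ℤ) → ∑[ y < n ] (𝟙ᵤ y * G y) ≡ ∑< n G - ∑[ j < q ] G (j ℕ.* p)
  ∑-units G = begin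
    ∑[ y < n ] (𝟙ᵤ y * G y)                         ≡⟨ ∑-cong n (λ y _ → trans (cong (_* G y) (𝟙ᵤ≡1-𝟙p∣ y)) (distrib (𝟙 (p ℕ∣.∣? y)) (G y))) ⟩
    ∑[ y < n ] (G y - 𝟙 (p ℕ∣.∣? y) * G y)         ≡⟨ ∑-distrib-- n G _ ⟩
    ∑< n G - ∑[ y < n ] (𝟙 (p ℕ∣.∣? y) * G y)      ≡⟨ cong (λ t → ∑< n G - t) (trans (cong (λ N → ∑< N (λ y → 𝟙 (p ℕ∣.∣? y) * G y)) (ℕ.*-comm p q)) (∑-multiples q G)) ⟩
    ∑< n G - ∑[ j < q ] G (j ℕ.* p)                 ∎
    where distrib : ∀ d g → (1ℤ - d) * g ≡ g - d * g
          distrib = solve-∀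

  ∑-𝟙ᵤ : ∑< n 𝟙ᵤ ≡ + n - + q
  ∑-𝟙ᵤ = begin
    ∑< n 𝟙ᵤ                                  ≡⟨ ∑-cong n (λ y _ → sym (*-identityʳ (𝟙ᵤ y))) ⟩
    ∑[ y < n ] (𝟙ᵤ y * 1ℤ)                   ≡⟨ ∑-units (λ _ → 1ℤ) ⟩
    ∑[ y < n ] 1ℤ - ∑[ j < q ] 1ℤ            ≡⟨ cong₂ _-_ (trans (∑-const n 1ℤ) (*-identityʳ (+ n))) (trans (∑-const q 1ℤ) (*-identityʳ (+ q))) ⟩
    + n - + q                                ∎

-1^odd : ∀ {m} → ¬ 2 ℕ∣.∣ m → -1ℤ ℤ.^ m ≡ -1ℤ
-1^odd {zero}        odd = ⊥-elim (odd (2 ℕ∣.∣0))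
-1^odd {suc zero}    odd = refl
-1^odd {suc (suc m)} odd = begin
  -1ℤ * (-1ℤ * -1ℤ ℤ.^ m)  ≡⟨ sym (*-assoc -1ℤ -1ℤ (-1ℤ ℤ.^ m)) ⟩
  1ℤ * -1ℤ ℤ.^ m           ≡⟨ *-identityˡ _ ⟩
  -1ℤ ℤ.^ m                ≡⟨ -1^odd (odd ∘ ℕ∣.∣m∣n⇒∣m+n (ℕ∣.∣-refl {2})) ⟩
  -1ℤ                      ∎

module OddPrimePower {p : ℕ} (prime : Prime p) (odd : ¬ 2 ℕ∣.∣ p) (k : ℕ) (χ : ℤ → ℤ)
                     (isχ : IsDirichletChar (p ^ suc k) χ) (order2 : HasOrder2 (p ^ suc k) χ) where
  open PrimePower prime k
  open Residues n
  open QuadraticCharacter n χ isχ order2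
  open IsDirichletChar isχ
  open HasOrder2 order2

  p∤2 : ¬ + p ℤ∣.∣ + 2
  p∤2 p∣2 with ℕ.≤-antisym (ℕ∣.∣⇒≤ (ℤ∣.∣⇒∣ᵤ p∣2)) 1<p
  ... | refl = odd ℕ∣.∣-refl

  pʲ-odd : ∀ j → ¬ 2 ℕ∣.∣ p ^ j
  pʲ-odd zero    2∣1    = ℕ.<⇒≢ (s≤s (s≤s z≤n)) (sym (∣1⇒≡1 2∣1))
  pʲ-odd (suc j) 2∣pʲ⁺¹ with euclidsLemma p (p ^ j) prime[2] 2∣pʲ⁺¹
  ... | inj₁ 2∣p  = odd 2∣p
  ... | inj₂ 2∣pʲ = pʲ-odd j 2∣pʲ

  χ-≡1-mod-p : ∀ {w} → w ≡ 1ℤ mod p → χ w ≡ 1ℤ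
  χ-≡1-mod-p {w} w≡1 with χ-±1 (unit⇒coprime (unit-mod w≡1 unit-1))
  ... | inj₁ χw≡1  = χw≡1
  ... | inj₂ χw≡-1 = ⊥-elim (-1≢1 (begin
    -1ℤ              ≡⟨ sym (-1^odd (pʲ-odd k)) ⟩
    -1ℤ ℤ.^ q        ≡⟨ cong (ℤ._^ q) (sym χw≡-1) ⟩
    χ w ℤ.^ q        ≡⟨ sym (χ-^ w q) ⟩
    χ (w ℤ.^ q)      ≡⟨ χ-mod (^-lift k w w≡1) ⟩
    χ 1ℤ             ≡⟨ one ⟩
    1ℤ               ∎))
    where -1≢1 : -1ℤ ≢ 1ℤ
          -1≢1 ()

  χ-mod-p : ∀ {u v} → u ≡ v mod p → IsUnit v → χ u ≡ χ v
  χ-mod-p {u} {v} u≡v unit-v with inverse-mod v (unit⇒coprime unit-v)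
  ... | v' , vv'≡1 = *≡1-unique
    (trans (sym (multiplicative u v')) (χ-≡1-mod-p (mod-trans (*-cong-mod u≡v (mod-refl v')) (mod-weaken p∣n vv'≡1))))
    (χ-inverse vv'≡1)

  n∣*unit⇒n∣ : ∀ {a b} → IsUnit b → + n ℤ∣.∣ a * b → + n ℤ∣.∣ a
  n∣*unit⇒n∣ {a} {b} unit-b n∣ab = ℤ∣.∣ᵤ⇒∣ (coprime-divisor (Coprime.sym (unit⇒coprime unit-b))
    (subst (n ℕ∣.∣_) (trans (abs-* a b) (ℕ.*-comm ∣ a ∣ ∣ b ∣)) (ℤ∣.∣⇒∣ᵤ n∣ab)))

  square-roots : ∀ {x z} → IsUnit z → x * x ≡ z * z mod n → x ≡ z mod n ⊎ x ≡ - z mod n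
  square-roots {x} {z} unit-z (≡mod n∣x²-z²) = by-cases (+ p ℤ∣.∣? x + z)
    where
    n∣[x-z][x+z] : + n ℤ∣.∣ (x - z) * (x + z)
    n∣[x-z][x+z] = subst (+ n ℤ∣.∣_) (difference-of-squares x z) n∣x²-z²
      where difference-of-squares : ∀ x z → x * x - z * z ≡ (x - z) * (x + z)
            difference-of-squares = solve-∀
    n∣[x+z][x-z] : + n ℤ∣.∣ (x + z) * (x - z)
    n∣[x+z][x-z] = subst (+ n ℤ∣.∣_) (*-comm (x - z) (x + z)) n∣[x-z][x+z]
    -- p cannot divide both x - z and x + z, as it would then divide 2z.
    unit-x-z : + p ℤ∣.∣ x + z → IsUnit (x - z)
    unit-x-z p∣x+z p∣x-z = unit-* p∤2 unit-z (subst (+ p ℤ∣.∣_) ([x+z]-[x-z]≡2z x z) (ℤ∣.∣m∣n⇒∣m-n p∣x+z p∣x-z))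
      where [x+z]-[x-z]≡2z : ∀ x z → (x + z) - (x - z) ≡ + 2 * z
            [x+z]-[x-z]≡2z = solve-∀
    x+z≡x--z : ∀ x z → x + z ≡ x - - z
    x+z≡x--z = solve-∀
    by-cases : Dec (+ p ℤ∣.∣ x + z) → x ≡ z mod n ⊎ x ≡ - z mod n
    by-cases (no ¬p∣x+z) = inj₁ (≡mod (n∣*unit⇒n∣ ¬p∣x+z n∣[x-z][x+z]))
    by-cases (yes p∣x+z) = inj₂ (≡mod (subst (+ n ℤ∣.∣_) (x+z≡x--z x z) (n∣*unit⇒n∣ (unit-x-z p∣x+z) n∣[x+z][x-z])))

  square : ℕ → ℕ
  square x = residue (+ x * + x)

  IsRoot : ℕ → ℕ → Set
  IsRoot y x = Coprime x n × y ≡ square x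

  isRoot? : ∀ y x → Dec (IsRoot y x)
  isRoot? y x = coprime? x n ×-dec (y ℕ.≟ square x)

  roots : ℕ → ℤ
  roots y = ∑[ x < n ] 𝟙 (isRoot? y x)

  root⇒square : ∀ {y x} → IsRoot y x → + y ≡ + x * + x mod n
  root⇒square {y} {x} (_ , refl) = mod-sym (residue-mod (+ x * + x))

  root⇒unit-square : ∀ {y x} → IsRoot y x → Coprime y n × χ (+ y) ≡ 1ℤ
  root⇒unit-square {y} {x} root@(coprime , _) =
    unit⇒coprime (unit-mod (mod-weaken p∣n (root⇒square root)) (unit-* (coprime⇒unit {+ x} coprime) (coprime⇒unit {+ x} coprime))) ,
    trans (χ-mod (root⇒square root)) (trans (multiplicative (+ x) (+ x)) (square-principal (+ x) coprime))

  ρ : ℕ → ℤ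
  ρ y = 𝟙ᵤ y * (1ℤ + χ (+ y))

  ρ≡0∨2 : ∀ y → ρ y ≡ 0ℤ ⊎ ρ y ≡ + 2
  ρ≡0∨2 y = by-cases (coprime? y n)
    where
    by-cases : Dec (Coprime y n) → ρ y ≡ 0ℤ ⊎ ρ y ≡ + 2
    by-cases (no ¬coprime) = inj₁ (cong (_* (1ℤ + χ (+ y))) (𝟙-no (coprime? y n) ¬coprime))
    by-cases (yes coprime) with χ-±1 coprime
    ... | inj₁ χy≡1  = inj₂ (cong₂ (λ u c → u * (1ℤ + c)) (𝟙-yes (coprime? y n) coprime) χy≡1)
    ... | inj₂ χy≡-1 = inj₁ (cong₂ (λ u c → u * (1ℤ + c)) (𝟙-yes (coprime? y n) coprime) χy≡-1)

  0≤ρ : ∀ y → 0ℤ ℤ.≤ ρ y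
  0≤ρ y with ρ≡0∨2 y
  ... | inj₁ ≡0 = ≤-reflexive (sym ≡0)
  ... | inj₂ ≡2 = subst (0ℤ ℤ.≤_) (sym ≡2) (ℤ.+≤+ z≤n)

  roots-≤ : ∀ y → roots y ℤ.≤ ρ y
  roots-≤ y with anyUpTo? (isRoot? y) n
  ... | no ∄root = subst (ℤ._≤ ρ y) (sym roots≡0) (0≤ρ y)
    where roots≡0 : roots y ≡ 0ℤ
          roots≡0 = trans (∑-cong n (λ x x<n → 𝟙-no (isRoot? y x) (λ root → ∄root (x , x<n , root)))) (∑-zero n)
  ... | yes (x₀ , x₀<n , root₀) =
    ≤-trans (∑-mono-≤ n (λ x x<n → 𝟙-≤ (isRoot? y x) (root-is-±x₀ x<n) (+-mono-≤ (𝟙-nonneg (x ℕ.≟ x₀)) (𝟙-nonneg (x ℕ.≟ -x₀)))))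
            (≤-reflexive (begin
    ∑[ x < n ] (δ x x₀ + δ x -x₀)                 ≡⟨ ∑-distrib-+ n (λ x → δ x x₀) (λ x → δ x -x₀) ⟩
    ∑[ x < n ] δ x x₀ + ∑[ x < n ] δ x -x₀        ≡⟨ cong₂ _+_ (∑-δ-1 n x₀<n) (∑-δ-1 n (residue-< (- + x₀))) ⟩
    + 2                                           ≡⟨ cong₂ (λ u c → u * (1ℤ + c)) (sym (𝟙-yes (coprime? y n) coprime-y)) (sym χy≡1) ⟩
    ρ y                                           ∎))
    where
    -x₀ : ℕ
    -x₀ = residue (- + x₀)
    coprime-y : Coprime y n
    coprime-y = proj₁ (root⇒unit-square root₀)
    χy≡1 : χ (+ y) ≡ 1ℤ
    χy≡1 = proj₂ (root⇒unit-square root₀)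
    root-is-±x₀ : ∀ {x} → x < n → IsRoot y x → 1ℤ ℤ.≤ δ x x₀ + δ x -x₀
    root-is-±x₀ {x} x<n root with square-roots (coprime⇒unit {+ x₀} (proj₁ root₀))
                                   (mod-trans (mod-sym (root⇒square root)) (root⇒square root₀))
    ... | inj₁ x≡x₀  = +-mono-≤ (≤-reflexive (sym (𝟙-yes (x ℕ.≟ x₀) (≡-mod⇒≡ x<n x₀<n x≡x₀)))) (𝟙-nonneg (x ℕ.≟ -x₀))
    ... | inj₂ x≡-x₀ = +-mono-≤ (𝟙-nonneg (x ℕ.≟ x₀)) (≤-reflexive (sym (𝟙-yes (x ℕ.≟ -x₀)
                         (≡-mod⇒≡ x<n (residue-< (- + x₀)) (mod-trans x≡-x₀ (residue-mod (- + x₀)))))))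

  𝟙ᵤ*χ≡χ : ∀ y → 𝟙ᵤ y * χ (+ y) ≡ χ (+ y)
  𝟙ᵤ*χ≡χ y = by-cases (coprime? y n)
    where
    by-cases : Dec (Coprime y n) → 𝟙ᵤ y * χ (+ y) ≡ χ (+ y)
    by-cases (yes coprime) = trans (cong (_* χ (+ y)) (𝟙-yes (coprime? y n) coprime)) (*-identityˡ _)
    by-cases (no ¬coprime) = trans (cong (_* χ (+ y)) (𝟙-no (coprime? y n) ¬coprime)) (sym (nonunit-zero (+ y) ¬coprime))

  ∑-roots : ∑< n roots ≡ ∑< n 𝟙ᵤ
  ∑-roots = begin
    ∑[ y < n ] ∑[ x < n ] 𝟙 (isRoot? y x)             ≡⟨ ∑-comm n n (λ y x → 𝟙 (isRoot? y x)) ⟩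
    ∑[ x < n ] ∑[ y < n ] 𝟙 (isRoot? y x)             ≡⟨ ∑-cong n (λ x _ → ∑-cong n (λ y _ → 𝟙-× (coprime? x n) (y ℕ.≟ square x))) ⟩
    ∑[ x < n ] ∑[ y < n ] (𝟙ᵤ x * δ y (square x))     ≡⟨ ∑-cong n (λ x _ → sym (*-distribˡ-∑ n (𝟙ᵤ x) (λ y → δ y (square x)))) ⟩
    ∑[ x < n ] (𝟙ᵤ x * ∑[ y < n ] δ y (square x))     ≡⟨ ∑-cong n (λ x _ → cong (𝟙ᵤ x *_) (∑-δ-1 n (residue-< (+ x * + x)))) ⟩
    ∑[ x < n ] (𝟙ᵤ x * 1ℤ)                             ≡⟨ ∑-cong n (λ x _ → *-identityʳ (𝟙ᵤ x)) ⟩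
    ∑< n 𝟙ᵤ                                            ∎

  ∑-ρ : ∑< n ρ ≡ ∑< n 𝟙ᵤ
  ∑-ρ = begin
    ∑< n ρ                                     ≡⟨ ∑-cong n (λ y _ → trans (*-distribˡ-+ (𝟙ᵤ y) 1ℤ (χ (+ y))) (cong₂ _+_ (*-identityʳ (𝟙ᵤ y)) (𝟙ᵤ*χ≡χ y))) ⟩
    ∑[ y < n ] (𝟙ᵤ y + χ (+ y))                ≡⟨ ∑-distrib-+ n 𝟙ᵤ (χ ∘ +_) ⟩
    ∑< n 𝟙ᵤ + ∑[ y < n ] χ (+ y)               ≡⟨ cong (_+_ (∑< n 𝟙ᵤ)) ∑-χ ⟩
    ∑< n 𝟙ᵤ + 0ℤ                               ≡⟨ +-identityʳ _ ⟩
    ∑< n 𝟙ᵤ                                    ∎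

  roots-formula : ∀ {y} → y < n → roots y ≡ ρ y
  roots-formula {y} = ∑-mono-≤-≡ n (λ y _ → roots-≤ y) (trans ∑-roots (sym ∑-ρ)) y

  ∑-χ[y-a]-units : ∀ {a} → Coprime a n → ∑[ y < n ] (𝟙ᵤ y * χ (+ y - + a)) ≡ - (+ q * χ (- + a))
  ∑-χ[y-a]-units {a} coprime = begin
    ∑[ y < n ] (𝟙ᵤ y * χ (+ y - + a))                          ≡⟨ ∑-units (λ y → χ (+ y - + a)) ⟩
    ∑[ y < n ] χ (+ y - + a) - ∑[ j < q ] χ (+ (j ℕ.* p) - + a)
      ≡⟨ cong₂ _-_ (trans (∑-cong n (λ y _ → cong (λ t → χ (t - + a)) (sym (*-identityˡ (+ y))))) (∑-χ-affine 1ℤ (unit⇒coprime unit-1) (- + a)))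
                   (trans (∑-cong q (λ j _ → χ-mod-p (jp-a≡-a j) unit--a)) (∑-const q (χ (- + a)))) ⟩
    0ℤ - + q * χ (- + a)                                       ≡⟨ +-identityˡ _ ⟩
    - (+ q * χ (- + a))                                        ∎
    where
    unit--a : IsUnit (- + a)
    unit--a p∣-a = coprime⇒unit {+ a} coprime (subst (+ p ℤ∣.∣_) (neg-involutive (+ a)) (ℤ∣.∣m⇒∣-m p∣-a))
    jp-a≡-a : ∀ j → + (j ℕ.* p) - + a ≡ - + a mod p
    jp-a≡-a j = ≡mod (divides (+ j) (trans (cancel (+ (j ℕ.* p)) (+ a)) (pos-* j p)))
      where cancel : ∀ x a → x - a - - a ≡ x
            cancel = solve-∀

  χ[y]χ[y-a]≡χ[1-a/y] : ∀ a {y} → Coprime y n → χ (+ y) * χ (+ y - + a) ≡ χ (1ℤ - + a * + invert y)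
  χ[y]χ[y-a]≡χ[1-a/y] a {y} coprime = begin
    χ y' * χ (y' - a')                             ≡⟨ sym (multiplicative y' (y' - a')) ⟩
    χ (y' * (y' - a'))                             ≡⟨ sym (*-identityʳ _) ⟩
    χ (y' * (y' - a')) * 1ℤ                        ≡⟨ cong (χ (y' * (y' - a')) *_) (sym (square-principal z (invert-coprime coprime))) ⟩
    χ (y' * (y' - a')) * (χ z * χ z)               ≡⟨ cong (χ (y' * (y' - a')) *_) (sym (multiplicative z z)) ⟩
    χ (y' * (y' - a')) * χ (z * z)                 ≡⟨ sym (multiplicative _ _) ⟩
    χ ((y' * (y' - a')) * (z * z))                 ≡⟨ cong χ (regroup y' a' z) ⟩
    χ ((y' * z) * ((y' * z) - a' * z))             ≡⟨ χ-mod (*-cong-mod yz≡1 (+-cong-mod yz≡1 (mod-refl (- (a' * z))))) ⟩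
    χ (1ℤ * (1ℤ - a' * z))                         ≡⟨ cong χ (*-identityˡ _) ⟩
    χ (1ℤ - a' * z)                                ∎
    where
    y' a' z : ℤ
    y' = + y
    a' = + a
    z = + invert y
    yz≡1 : y' * z ≡ 1ℤ mod n
    yz≡1 = invert-inverse coprime
    regroup : ∀ y a z → (y * (y - a)) * (z * z) ≡ (y * z) * ((y * z) - a * z)
    regroup = solve-∀

  𝟙ᵤ-invert : ∀ {y} → y < n → 𝟙ᵤ (invert y) ≡ 𝟙ᵤ y
  𝟙ᵤ-invert {y} y<n = 𝟙-cong (coprime? (invert y) n) (coprime? y n)
    (λ coprime → subst (λ t → Coprime t n) (invert-involutive y<n) (invert-coprime coprime)) invert-coprime

  𝟙ᵤ-affine : ∀ {a} → Coprime a n → ∀ z → 𝟙ᵤ (affine (+ a) 0ℤ z) ≡ 𝟙ᵤ z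
  𝟙ᵤ-affine {a} coprime-a z = 𝟙-cong (coprime? w n) (coprime? z n)
    (λ coprime-w → unit⇒coprime {+ z} (λ p∣z → coprime⇒unit {+ w} coprime-w
       (∣-respects-mod w≡az (subst (+ p ℤ∣.∣_) (sym (+-identityʳ _)) (ℤ∣.∣n⇒∣m*n (+ a) p∣z)))))
    (λ coprime-z → unit⇒coprime {+ w} (unit-mod w≡az
       (unit-* (coprime⇒unit {+ a} coprime-a) (coprime⇒unit {+ z} coprime-z) ∘ subst (+ p ℤ∣.∣_) (+-identityʳ _))))
    where
    w : ℕ
    w = affine (+ a) 0ℤ z
    w≡az : + w ≡ + a * + z + 0ℤ mod p
    w≡az = mod-weaken p∣n (affine-mod (+ a) 0ℤ z)

  ∑-χ[y]χ[y-a]-units : ∀ {a} → Coprime a n → ∑[ y < n ] (𝟙ᵤ y * (χ (+ y) * χ (+ y - + a))) ≡ - + q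
  ∑-χ[y]χ[y-a]-units {a} coprime-a with inverse-mod (+ a) coprime-a
  ... | a' , aa'≡1 = begin
    ∑[ y < n ] (𝟙ᵤ y * (χ (+ y) * χ (+ y - + a)))
      ≡⟨ ∑-cong n (λ y y<n → trans (𝟙-*-cong (coprime? y n) (χ[y]χ[y-a]≡χ[1-a/y] a)) (cong (_* χ (1ℤ - + a * + invert y)) (sym (𝟙ᵤ-invert y<n)))) ⟩
    ∑[ y < n ] F (invert y)
      ≡⟨ ∑-reindex n invert invert (λ _ → invert-<) (λ _ → invert-<) (λ _ → invert-involutive) (λ _ → invert-involutive) F ⟩
    ∑< n F
      ≡⟨ ∑-cong n (λ z _ → cong₂ _*_ (sym (𝟙ᵤ-affine coprime-a z)) (χ-mod (+-cong-mod (mod-refl 1ℤ) (-‿cong-mod (az≡w z))))) ⟩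
    ∑[ z < n ] G (affine (+ a) 0ℤ z)
      ≡⟨ ∑-affine (+ a) a' aa'≡1 0ℤ G ⟩
    ∑< n G
      ≡⟨ ∑-units (λ w → χ (1ℤ - + w)) ⟩
    ∑[ w < n ] χ (1ℤ - + w) - ∑[ j < q ] χ (1ℤ - + (j ℕ.* p))
      ≡⟨ cong₂ _-_ (trans (∑-cong n (λ w _ → cong χ (1-w≡-w+1 (+ w)))) (∑-χ-affine -1ℤ (unit⇒coprime unit--1) 1ℤ))
                   (trans (∑-cong q (λ j _ → χ-≡1-mod-p (1-jp≡1 j))) (∑-const q 1ℤ)) ⟩
    0ℤ - + q * 1ℤ
      ≡⟨ trans (+-identityˡ _) (cong -_ (*-identityʳ (+ q))) ⟩
    - + q ∎
    where
    F G : ℕ → ℤ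
    F z = 𝟙ᵤ z * χ (1ℤ - + a * + z)
    G w = 𝟙ᵤ w * χ (1ℤ - + w)
    az≡w : ∀ z → + a * + z ≡ + affine (+ a) 0ℤ z mod n
    az≡w z = mod-sym (mod-trans (affine-mod (+ a) 0ℤ z) (mod-reflexive (+-identityʳ (+ a * + z))))
    unit--1 : IsUnit -1ℤ
    unit--1 p∣-1 = unit-1 (ℤ∣.∣m⇒∣-m p∣-1)
    1-w≡-w+1 : ∀ w → 1ℤ - w ≡ -1ℤ * w + 1ℤ
    1-w≡-w+1 = solve-∀
    1-jp≡1 : ∀ j → 1ℤ - + (j ℕ.* p) ≡ 1ℤ mod p
    1-jp≡1 j = ≡mod (divides (- + j) (trans (cancel (+ (j ℕ.* p))) (trans (cong -_ (pos-* j p)) (neg-distribˡ-* (+ j) (+ p)))))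
      where cancel : ∀ x → 1ℤ - x - 1ℤ ≡ - x
            cancel = solve-∀

  𝟙ᵤ*χ[x²-a] : ∀ a x → 𝟙ᵤ x * χ (+ x * + x - + a) ≡ ∑[ y < n ] (𝟙 (isRoot? y x) * χ (+ y - + a))
  𝟙ᵤ*χ[x²-a] a x = begin
    𝟙ᵤ x * χ (+ x * + x - + a)                              ≡⟨ cong (𝟙ᵤ x *_) (χ-mod (+-cong-mod (residue-mod (+ x * + x)) (mod-refl (- + a)))) ⟩
    𝟙ᵤ x * χ (+ square x - + a)                             ≡⟨ cong (𝟙ᵤ x *_) (sym (∑-δ n (λ y → χ (+ y - + a)) (residue-< (+ x * + x)))) ⟩
    𝟙ᵤ x * ∑[ y < n ] (δ y (square x) * χ (+ y - + a))      ≡⟨ *-distribˡ-∑ n (𝟙ᵤ x) _ ⟩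
    ∑[ y < n ] (𝟙ᵤ x * (δ y (square x) * χ (+ y - + a)))    ≡⟨ ∑-cong n (λ y _ → trans (sym (*-assoc (𝟙ᵤ x) _ _)) (cong (_* χ (+ y - + a)) (sym (𝟙-× (coprime? x n) (y ℕ.≟ square x))))) ⟩
    ∑[ y < n ] (𝟙 (isRoot? y x) * χ (+ y - + a))            ∎

  ∑-χ[x²-a]-units : ∀ {a} → Coprime a n → ∑[ x < n ] (𝟙ᵤ x * χ (+ x * + x - + a)) ≡ - ((χ (- + a) + 1ℤ) * + q)
  ∑-χ[x²-a]-units {a} coprime-a = begin
    ∑[ x < n ] (𝟙ᵤ x * χ (+ x * + x - + a))
      ≡⟨ ∑-cong n (λ x _ → 𝟙ᵤ*χ[x²-a] a x) ⟩
    ∑[ x < n ] ∑[ y < n ] (𝟙 (isRoot? y x) * χ (+ y - + a))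
      ≡⟨ ∑-comm n n _ ⟩
    ∑[ y < n ] ∑[ x < n ] (𝟙 (isRoot? y x) * χ (+ y - + a))
      ≡⟨ ∑-cong n (λ y _ → sym (*-distribʳ-∑ n (χ (+ y - + a)) (λ x → 𝟙 (isRoot? y x)))) ⟩
    ∑[ y < n ] (roots y * χ (+ y - + a))
      ≡⟨ ∑-cong n (λ y y<n → trans (cong (_* χ (+ y - + a)) (roots-formula y<n)) (distrib (𝟙ᵤ y) (χ (+ y)) (χ (+ y - + a)))) ⟩
    ∑[ y < n ] (𝟙ᵤ y * χ (+ y - + a) + 𝟙ᵤ y * (χ (+ y) * χ (+ y - + a)))
      ≡⟨ ∑-distrib-+ n _ _ ⟩
    ∑[ y < n ] (𝟙ᵤ y * χ (+ y - + a)) + ∑[ y < n ] (𝟙ᵤ y * (χ (+ y) * χ (+ y - + a)))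
      ≡⟨ cong₂ _+_ (∑-χ[y-a]-units coprime-a) (∑-χ[y]χ[y-a]-units coprime-a) ⟩
    - (+ q * χ (- + a)) + - + q
      ≡⟨ collect (+ q) (χ (- + a)) ⟩
    - ((χ (- + a) + 1ℤ) * + q)  ∎
    where
    distrib : ∀ u c d → u * (1ℤ + c) * d ≡ u * d + u * (c * d)
    distrib = solve-∀
    collect : ∀ q c → - (q * c) + - q ≡ - ((c + 1ℤ) * q)
    collect = solve-∀

  minus-one : ℕ
  minus-one = residue -1ℤ

  1<n : 1 < n
  1<n = ℕ.<-≤-trans 1<p (ℕ.m≤m*n p q)

  1≢minus-one : 1 ≢ minus-one
  1≢minus-one 1≡-1 = p∤2 (divides-difference (mod-weaken p∣n
    (mod-trans (mod-reflexive (cong +_ 1≡-1)) (mod-sym (residue-mod -1ℤ)))))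

  invert-self : ∀ {y} → y < n → + y * + y ≡ 1ℤ mod n → invert y ≡ y
  invert-self {y} y<n yy≡1 = ≡-mod⇒≡ (invert-< y<n) y<n
    (inverse-unique {+ y} (invert-inverse (inverse⇒coprime {+ y} yy≡1)) yy≡1)

  minus-one² : + minus-one * + minus-one ≡ 1ℤ mod n
  minus-one² = *-cong-mod (mod-sym (residue-mod -1ℤ)) (mod-sym (residue-mod -1ℤ))

  invert-self⇒±1 : ∀ {y} → y < n → Coprime y n → invert y ≡ y → y ≡ 1 ⊎ y ≡ minus-one
  invert-self⇒±1 {y} y<n coprime fixed
    with square-roots unit-1 (subst (λ z → + y * + z ≡ 1ℤ mod n) fixed (invert-inverse coprime))
  ... | inj₁ y≡1  = inj₁ (≡-mod⇒≡ y<n 1<n y≡1)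
  ... | inj₂ y≡-1 = inj₂ (≡-mod⇒≡ y<n (residue-< -1ℤ) (mod-trans y≡-1 (residue-mod -1ℤ)))

  δ-invert-unit : ∀ {y} → y < n → Coprime y n → δ (invert y) y ≡ δ y 1 + δ y minus-one
  δ-invert-unit {y} y<n coprime = by-cases (invert y ℕ.≟ y)
    where
    by-cases : Dec (invert y ≡ y) → δ (invert y) y ≡ δ y 1 + δ y minus-one
    by-cases (yes fixed) with invert-self⇒±1 y<n coprime fixed
    ... | inj₁ refl = trans (𝟙-yes (invert 1 ℕ.≟ 1) fixed)
                            (sym (cong₂ _+_ (δ-refl 1) (𝟙-no (1 ℕ.≟ minus-one) 1≢minus-one)))
    ... | inj₂ refl = trans (𝟙-yes (invert minus-one ℕ.≟ minus-one) fixed)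
                            (sym (cong₂ _+_ (𝟙-no (minus-one ℕ.≟ 1) (1≢minus-one ∘ sym)) (δ-refl minus-one)))
    by-cases (no moved) = trans (𝟙-no (invert y ℕ.≟ y) moved) (sym (cong₂ _+_
      (𝟙-no (y ℕ.≟ 1) (λ { refl → moved (invert-self 1<n (mod-refl 1ℤ)) }))
      (𝟙-no (y ℕ.≟ minus-one) (λ { refl → moved (invert-self (residue-< -1ℤ) minus-one²) }))))

  δ-invert : ∀ {y} → y < n → δ (invert y) y * ρ y ≡ (δ y 1 + δ y minus-one) * ρ y
  δ-invert {y} y<n = by-cases (coprime? y n)
    where
    ρ≡0 : ¬ Coprime y n → ρ y ≡ 0ℤ
    ρ≡0 ¬coprime = cong (_* (1ℤ + χ (+ y))) (𝟙-no (coprime? y n) ¬coprime)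
    by-cases : Dec (Coprime y n) → δ (invert y) y * ρ y ≡ (δ y 1 + δ y minus-one) * ρ y
    by-cases (yes coprime) = cong (_* ρ y) (δ-invert-unit y<n coprime)
    by-cases (no ¬coprime) = trans (cong (δ (invert y) y *_) (ρ≡0 ¬coprime))
      (trans (*-zeroʳ (δ (invert y) y)) (sym (trans (cong ((δ y 1 + δ y minus-one) *_) (ρ≡0 ¬coprime)) (*-zeroʳ (δ y 1 + δ y minus-one)))))

  2∣ρ : ∀ y → + 2 ℤ∣.∣ ρ y
  2∣ρ y with ρ≡0∨2 y
  ... | inj₁ ρ≡0 = divides 0ℤ ρ≡0
  ... | inj₂ ρ≡2 = divides 1ℤ ρ≡2

  ρ-invert : ∀ y → y < n → ρ (invert y) ≡ ρ y
  ρ-invert y y<n = cong₂ (λ u c → u * (1ℤ + c)) (𝟙ᵤ-invert y<n) (χ-invert y)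

  ∑-δ-invert : ∑[ y < n ] (δ (invert y) y * ρ y) ≡ + 2 + (1ℤ + χ -1ℤ)
  ∑-δ-invert = begin
    ∑[ y < n ] (δ (invert y) y * ρ y)                      ≡⟨ ∑-cong n (λ y y<n → trans (δ-invert y<n) (*-distribʳ-+ (ρ y) (δ y 1) (δ y minus-one))) ⟩
    ∑[ y < n ] (δ y 1 * ρ y + δ y minus-one * ρ y)         ≡⟨ ∑-distrib-+ n _ _ ⟩
    ∑[ y < n ] (δ y 1 * ρ y) + ∑[ y < n ] (δ y minus-one * ρ y)
                                                           ≡⟨ cong₂ _+_ (∑-δ n ρ 1<n) (∑-δ n ρ (residue-< -1ℤ)) ⟩
    ρ 1 + ρ minus-one                                      ≡⟨ cong₂ _+_ (cong₂ (λ u c → u * (1ℤ + c)) (𝟙-yes (coprime? 1 n) (unit⇒coprime unit-1)) one)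
                                                                        (cong₂ (λ u c → u * (1ℤ + c)) (𝟙-yes (coprime? minus-one n) (inverse⇒coprime {+ minus-one} minus-one²)) (χ-residue -1ℤ)) ⟩
    + 2 + 1ℤ * (1ℤ + χ -1ℤ)                                ≡⟨ cong (_+_ (+ 2)) (*-identityˡ (1ℤ + χ -1ℤ)) ⟩
    + 2 + (1ℤ + χ -1ℤ)                                     ∎

  ∑-𝟙ᵤ≡3+χ[-1] : ∑< n 𝟙ᵤ ≡ + 3 + χ -1ℤ mod 4
  ∑-𝟙ᵤ≡3+χ[-1] with ∑-∣ n (λ y → 𝟙 (y ℕ.<? invert y) * ρ y) (λ y _ → ℤ∣.∣n⇒∣m*n (𝟙 (y ℕ.<? invert y)) (2∣ρ y))
  ... | divides t A≡2t = ≡mod (divides t (begin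
    ∑< n 𝟙ᵤ - (+ 3 + χ -1ℤ)                              ≡⟨ cong (_- (+ 3 + χ -1ℤ)) (sym ∑-ρ) ⟩
    ∑< n ρ - (+ 3 + χ -1ℤ)                               ≡⟨ cong (_- (+ 3 + χ -1ℤ)) (∑-involution n invert (λ _ → invert-<) (λ _ → invert-involutive) ρ ρ-invert) ⟩
    ∑[ y < n ] (δ (invert y) y * ρ y) + (A + A) - (+ 3 + χ -1ℤ)
                                                         ≡⟨ cong₂ (λ f a → f + (a + a) - (+ 3 + χ -1ℤ)) ∑-δ-invert A≡2t ⟩
    + 2 + (1ℤ + χ -1ℤ) + (t * + 2 + t * + 2) - (+ 3 + χ -1ℤ)
                                                         ≡⟨ cancel (χ -1ℤ) t ⟩
    t * + 4                                              ∎))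
    where
    A : ℤ
    A = ∑[ y < n ] (𝟙 (y ℕ.<? invert y) * ρ y)
    cancel : ∀ c t → + 2 + (1ℤ + c) + (t * + 2 + t * + 2) - (+ 3 + c) ≡ t * + 4
    cancel = solve-∀

module OneModFour {p : ℕ} (prime : Prime p) (m : ℕ) (p≡1+4m : p ≡ suc (4 ℕ.* m)) (k : ℕ) (χ : ℤ → ℤ)
                  (isχ : IsDirichletChar (p ^ suc k) χ) (order2 : HasOrder2 (p ^ suc k) χ) where
  open PrimePower prime k
  open QuadraticCharacter n χ isχ order2
  open IsDirichletChar isχ

  odd : ¬ 2 ℕ∣.∣ p
  odd 2∣p = ℕ.<⇒≢ (s≤s (s≤s z≤n)) (sym (∣1⇒≡1 (ℕ∣.∣m+n∣m⇒∣n (subst (2 ℕ∣.∣_) (trans p≡1+4m (ℕ.+-comm 1 (4 ℕ.* m))) 2∣p)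
                                                               (ℕ∣.∣-trans (ℕ∣.divides 2 refl) (ℕ∣.m∣m*n m)))))

  open OddPrimePower prime odd k χ isχ order2

  4∣∑𝟙ᵤ : + 4 ℤ∣.∣ ∑< n 𝟙ᵤ
  4∣∑𝟙ᵤ = divides (+ (m ℕ.* q)) (begin
    ∑< n 𝟙ᵤ                          ≡⟨ ∑-𝟙ᵤ ⟩
    + (p ℕ.* q) - + q                 ≡⟨ cong (λ p′ → + (p′ ℕ.* q) - + q) p≡1+4m ⟩
    + (suc (4 ℕ.* m) ℕ.* q) - + q     ≡⟨ cong (_- + q) (trans (pos-* (suc (4 ℕ.* m)) q) (cong (_* + q) (trans (pos-+ 1 (4 ℕ.* m)) (cong (_+_ 1ℤ) (pos-* 4 m))))) ⟩
    (1ℤ + + 4 * + m) * + q - + q      ≡⟨ cancel (+ m) (+ q) ⟩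
    + m * + q * + 4                   ≡⟨ cong (_* + 4) (sym (pos-* m q)) ⟩
    + (m ℕ.* q) * + 4                 ∎)
    where cancel : ∀ m q → (1ℤ + + 4 * m) * q - q ≡ m * q * + 4
          cancel = solve-∀

  χ[-1]≡1 : χ -1ℤ ≡ 1ℤ
  χ[-1]≡1 with χ-±1 { -1ℤ} (unit⇒coprime { -1ℤ} (unit-1 ∘ ℤ∣.∣m⇒∣-m {+ p} { -1ℤ}))
  ... | inj₁ χ[-1]≡1  = χ[-1]≡1
  ... | inj₂ χ[-1]≡-1 = ⊥-elim (ℕ.<⇒≱ (s≤s (s≤s (s≤s z≤n))) (ℕ∣.∣⇒≤ (ℤ∣.∣⇒∣ᵤ 4∣2)))
    where
    4∣2 : + 4 ℤ∣.∣ + 2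
    4∣2 = divides-difference (mod-trans {x = + 2} {y = ∑< n 𝟙ᵤ} {z = 0ℤ} (mod-sym (subst (λ c → ∑< n 𝟙ᵤ ≡ + 3 + c mod 4) χ[-1]≡-1 ∑-𝟙ᵤ≡3+χ[-1]))
                                        (≡mod (subst (+ 4 ℤ∣.∣_) (sym (+-identityʳ _)) 4∣∑𝟙ᵤ)))

  ∑-χ[x²-a]≡-[1+χ[a]]q : ∀ {a} → Coprime a n → ∑[ x < n ] (𝟙ᵤ x * χ (+ x * + x - + a)) ≡ - ((1ℤ + χ (+ a)) * + q)
  ∑-χ[x²-a]≡-[1+χ[a]]q {a} coprime = trans (∑-χ[x²-a]-units coprime) (cong (λ c → - (c * + q)) (trans (+-comm (χ (- + a)) 1ℤ) (cong (_+_ 1ℤ) χ[-a]≡χ[a])))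
    where χ[-a]≡χ[a] : χ (- + a) ≡ χ (+ a)
          χ[-a]≡χ[a] = trans (cong χ (sym (-1*i≡-i (+ a)))) (trans (multiplicative -1ℤ (+ a)) (trans (cong (_* χ (+ a)) χ[-1]≡1) (*-identityˡ _)))

p%4≡1⇒p≡1+4[p/4] : ∀ {p} → p % 4 ≡ 1 → p ≡ suc (4 ℕ.* (p ℕ./ 4))
p%4≡1⇒p≡1+4[p/4] {p} p%4≡1 = trans (m≡m%n+[m/n]*n p 4) (cong₂ ℕ._+_ p%4≡1 (ℕ.*-comm (p ℕ./ 4) 4))

lemma2p8 : (p α n : ℕ) → Prime p → p % 4 ≡ 1 → 1 ≤ α → n ≡ p ^ α →
           (χ : ℤ → ℤ) → IsDirichletChar n χ → HasOrder2 n χ →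
           (a : ℕ) → a < n → Coprime a n →
           sumℤ (map (λ x → χ (+ x * + x - + a)) (units n))
             ≡ - ((1ℤ + χ (+ a)) * + (p ^ (α ∸ 1)))
lemma2p8 p (suc k) .(p ^ suc k) prime p%4≡1 (s≤s z≤n) refl χ isχ order2 a _ coprime =
  trans (sumℤ-filter (λ x → coprime? x (p ^ suc k)) (λ x → χ (+ x * + x - + a)) (p ^ suc k) (λ x → x))
        (OneModFour.∑-χ[x²-a]≡-[1+χ[a]]q prime (p ℕ./ 4) (p%4≡1⇒p≡1+4[p/4] p%4≡1) k χ isχ order2 coprime)
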